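{- Consider the games POS-CNF and POS-DNF. If a player (Alice or Bob) has a winning strategy in POS-CNF (respectively POS-DNF) on a given formula, then that player also has a winning strategy on the same formula in the modified game in which the opponent is allowed to pass any of his or her turns.
   Context: POS-CNF: given variables $X_1,\dots,X_N$ and a formula in conjunctive normal form (a conjunction of disjunctions/clauses) in which only positive (unnegated) variables occur, two players alternate turns, each turn setting a previously unset variable to True or False, starting with Player I; after all variables are set, Player I wins iff the formula is True. POS-DNF is the same game with a formula in disjunctive normal form (a disjunction of conjunctions) of positive variables, Player I again starting and winning iff the formula is True. In POS-CNF Player I is called Alice and Player II is called Bob; in POS-DNF Player I is called Bob and Player II is called Alice. -}

module Defs where

open import Data.Nat using (ℕ)
open import Data.Fin using (Fin)
open import Data.Bool using (Bool; true; false)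
open import Data.Maybe using (Maybe; just; nothing)
open import Data.List using (List)
open import Data.List.Relation.Unary.All using (All)
open import Data.List.Relation.Unary.Any using (Any)
open import Data.Vec using (Vec; lookup; replicate; _[_]≔_)
open import Data.Product using (∃)
open import Relation.Binary.PropositionalEquality using (_≡_; _≢_)
open import Relation.Nullary using (¬_)
open import Data.Empty using (⊥)

-- Player I moves first; Player II second.
data Player : Set where
  I II : Player

other : Player → Player
other I = II
other II = I

data GameType : Set where
  CNF DNF : GameType

-- A positive formula over variables X_0 .. X_{N-1}: a list of clauses
-- (CNF) / terms (DNF), each a list of (unnegated) variables.
Formula : ℕ → Set
Formula N = List (List (Fin N))

-- A position's assignment: nothing = variable not yet set.
Assignment : ℕ → Set
Assignment N = Vec (Maybe Bool) N

IsTrue : ∀ {N} → Assignment N → Fin N → Set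
IsTrue a i = lookup a i ≡ just true

Complete : ∀ {N} → Assignment N → Set
Complete a = ∀ i → ∃ λ b → lookup a i ≡ just b

-- Truth of the formula (only consulted on complete assignments).
Satisfies : ∀ {N} → GameType → Assignment N → Formula N → Set
Satisfies CNF a φ = All (λ clause → Any (IsTrue a) clause) φ
Satisfies DNF a φ = Any (λ term → All (IsTrue a) term) φ

WinsAt : ∀ {N} → GameType → Formula N → Assignment N → Player → Set
WinsAt t φ a I = Satisfies t a φ
WinsAt t φ a II = ¬ Satisfies t a φ

-- Forces t φ mayPass p q a : in the game of type t on φ, where player
-- r may pass a turn iff mayPass r, player p has a winning strategy from
-- the position with current assignment a and player q to move.
data Forces {N : ℕ} (t : GameType) (φ : Formula N) (mayPass : Player → Set)
            (p : Player) : Player → Assignment N → Set where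
  end     : ∀ {q a} → Complete a → WinsAt t φ a p → Forces t φ mayPass p q a
  move    : ∀ {q a} → ¬ Complete a → q ≡ p →
            (i : Fin N) → lookup a i ≡ nothing → (b : Bool) →
            Forces t φ mayPass p (other q) (a [ i ]≔ just b) →
            Forces t φ mayPass p q a
  respond : ∀ {q a} → ¬ Complete a → q ≢ p →
            (∀ (i : Fin N) (b : Bool) → lookup a i ≡ nothing →
               Forces t φ mayPass p (other q) (a [ i ]≔ just b)) →
            (mayPass q → Forces t φ mayPass p (other q) a) →
            Forces t φ mayPass p q a

NoPass : Player → Set
NoPass _ = ⊥

OpponentMayPass : Player → Player → Set
OpponentMayPass p q = q ≡ other p

HasWinningStrategy : ∀ {N} → GameType → Formula N → (Player → Set) → Player → Set
HasWinningStrategy {N} t φ mayPass p = Forces t φ mayPass p I (replicate N nothing)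

-- Both formulas are positive, so the value of each variable is preferred by
-- one side: Player I wants it true, Player II wants it false.  Call an
-- assignment a an improvement of s for player p if, at every variable, a
-- agrees with s or s holds the value p's opponent prefers there (a may
-- even leave it unset).  Positivity makes winning monotone along this order.
--
-- Player p transfers a winning strategy to a game with different passing
-- rules by simulation: p keeps a simulated position s of the original game,
-- with the real position a an improvement of s.  An opponent's pass, or a
-- move on a variable already set in s, is answered in the simulation by a
-- phantom opponent move setting some unset variable to the value p dislikes.
-- Once the simulated game is over and won, every completion of the real
-- position is won as well, and the rest of the real game is played out
-- arbitrarily (the endgame lemma, by induction on the number of unset
-- variables).  The theorem is the special case of this simulation in which
-- the original game has no passes and the simulation starts with a = s.
module Submission where

open import Defs
open import Data.Nat using (ℕ; zero; suc)
open import Data.Nat.Properties using (suc-injective)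
open import Data.Fin using (zero; suc; _≟_)
open import Data.Fin.Properties using (any?)
open import Data.Bool using (Bool; true; false)
open import Data.Maybe using (Maybe; just; nothing)
open import Data.Vec using ([]; _∷_; lookup; _[_]≔_)
open import Data.Vec.Properties using (lookup∘update; lookup∘update′; []≔-lookup)
open import Data.Product using (∃; _,_; proj₂)
open import Data.Sum using (_⊎_; inj₁; inj₂)
open import Relation.Nullary using (¬_; Dec; yes; no; contradiction)
open import Relation.Binary.PropositionalEquality
  using (_≡_; _≢_; refl; sym; trans; cong; subst; subst₂)
import Data.List.Relation.Unary.All as All
import Data.List.Relation.Unary.Any as Any

_≟ᴾ_ : (q p : Player) → Dec (q ≡ p)
I  ≟ᴾ I  = yes refl
II ≟ᴾ II = yes refl
I  ≟ᴾ II = no λ ()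
II ≟ᴾ I  = no λ ()

other-of-≢ : ∀ {q p} → q ≢ p → other q ≡ p
other-of-≢ {I}  {I}  q≢p = contradiction refl q≢p
other-of-≢ {I}  {II} _   = refl
other-of-≢ {II} {I}  _   = refl
other-of-≢ {II} {II} q≢p = contradiction refl q≢p

disliked : Player → Bool
disliked I  = false
disliked II = true

is-unset? : (x : Maybe Bool) → Dec (x ≡ nothing)
is-unset? nothing  = yes refl
is-unset? (just _) = no λ ()

unset-or-complete : ∀ {N} (a : Assignment N) →
                    (∃ λ i → lookup a i ≡ nothing) ⊎ Complete a
unset-or-complete a with any? (λ i → is-unset? (lookup a i))
... | yes unset = inj₁ unset
... | no ¬unset = inj₂ λ i → set-at i
  where
  set-at : ∀ i → ∃ λ b → lookup a i ≡ just b
  set-at i with lookup a i in ai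
  ... | just b  = b , refl
  ... | nothing = contradiction (i , ai) ¬unset

unset⇒incomplete : ∀ {N} (a : Assignment N) i → lookup a i ≡ nothing → ¬ Complete a
unset⇒incomplete a i ai complete with complete i
... | b , ai′ with trans (sym ai) ai′
... | ()

set-stays-set : ∀ {N} (s : Assignment N) {j d} k v → lookup s j ≡ just d →
                ∃ λ e → lookup (s [ k ]≔ just v) j ≡ just e
set-stays-set s {j} k v sj with j ≟ k
... | yes refl = v , lookup∘update j s (just v)
... | no j≢k   = _ , trans (lookup∘update′ j≢k s (just v)) sj

unset-count : ∀ {N} → Assignment N → ℕ
unset-count []             = 0
unset-count (nothing ∷ a)  = suc (unset-count a)
unset-count (just _ ∷ a)   = unset-count a

unset-count-set : ∀ {N} (a : Assignment N) i b → lookup a i ≡ nothing →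
                  unset-count a ≡ suc (unset-count (a [ i ]≔ just b))
unset-count-set (nothing ∷ a) zero    b _  = refl
unset-count-set (nothing ∷ a) (suc i) b ai = cong suc (unset-count-set a i b ai)
unset-count-set (just _ ∷ a)  (suc i) b ai = unset-count-set a i b ai

data _≽⟨_⟩_ : Maybe Bool → Player → Maybe Bool → Set where
  same   : ∀ {p x} → x ≽⟨ p ⟩ x
  spoilt : ∀ {p x} → x ≽⟨ p ⟩ just (disliked p)

record Improves {N} (p : Player) (a s : Assignment N) : Set where
  constructor improves
  field at : ∀ i → lookup a i ≽⟨ p ⟩ lookup s i
open Improves

true-mono-I : ∀ {x y} → x ≽⟨ I ⟩ y → y ≡ just true → x ≡ just true
true-mono-I same   y-true = y-true
true-mono-I spoilt ()

true-mono-II : ∀ {x y} → x ≽⟨ II ⟩ y → x ≡ just true → y ≡ just true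
true-mono-II same   x-true = x-true
true-mono-II spoilt _      = refl

satisfies-mono : ∀ {N} t (φ : Formula N) {a b : Assignment N} →
                 (∀ i → IsTrue a i → IsTrue b i) → Satisfies t a φ → Satisfies t b φ
satisfies-mono CNF φ more-true = All.map (Any.map (λ {i} → more-true i))
satisfies-mono DNF φ more-true = Any.map (All.map (λ {i} → more-true i))

wins-mono : ∀ {N} t (φ : Formula N) p {a s : Assignment N} →
            Improves p a s → WinsAt t φ s p → WinsAt t φ a p
wins-mono t φ I  a≽s wins = satisfies-mono t φ (λ i → true-mono-I (at a≽s i)) wins
wins-mono t φ II a≽s wins = λ a-sat →
  wins (satisfies-mono t φ (λ i → true-mono-II (at a≽s i)) a-sat)

unset-improvement : ∀ {N p} {a s : Assignment N} i →
                    Improves p a s → lookup s i ≡ nothing → lookup a i ≡ nothing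
unset-improvement {p = p} {a} i a≽s si = unset (subst (lookup a i ≽⟨ p ⟩_) si (at a≽s i))
  where
  unset : ∀ {x} → x ≽⟨ p ⟩ nothing → x ≡ nothing
  unset same = refl

improves-update : ∀ {N p} {a s : Assignment N} i {x y} →
                  Improves p a s → x ≽⟨ p ⟩ y → Improves p (a [ i ]≔ x) (s [ i ]≔ y)
improves-update {a = a} {s} i {x} {y} a≽s x≽y = improves entry
  where
  entry : ∀ j → lookup (a [ i ]≔ x) j ≽⟨ _ ⟩ lookup (s [ i ]≔ y) j
  entry j with j ≟ i
  ... | yes refl rewrite lookup∘update j a x | lookup∘update j s y = x≽y
  ... | no j≢i   rewrite lookup∘update′ j≢i a x | lookup∘update′ j≢i s y = at a≽s j

improves-updateˡ : ∀ {N p} {a s : Assignment N} i {x} →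
                   Improves p a s → x ≽⟨ p ⟩ lookup s i → Improves p (a [ i ]≔ x) s
improves-updateˡ {p = p} {a} {s} i a≽s x≽si =
  subst (Improves p (a [ i ]≔ _)) ([]≔-lookup s i)
        (improves-update i a≽s x≽si)

improves-updateʳ : ∀ {N p} {a s : Assignment N} i {y} →
                   Improves p a s → lookup a i ≽⟨ p ⟩ y → Improves p a (s [ i ]≔ y)
improves-updateʳ {p = p} {a} {s} i a≽s ai≽y =
  subst (λ a′ → Improves p a′ (s [ i ]≔ _)) ([]≔-lookup a i)
        (improves-update i a≽s ai≽y)

-- A variable unset in a but set in s must hold the disliked value in s, so
-- a may set it to anything and still improve on s.
improves-fill : ∀ {N p} {a s : Assignment N} {j d} c → Improves p a s →
                lookup a j ≡ nothing → lookup s j ≡ just d →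
                Improves p (a [ j ]≔ just c) s
improves-fill {p = p} {j = j} c a≽s aj sj =
  improves-updateˡ j a≽s
    (subst (just c ≽⟨ p ⟩_) (sym sj) (fill (subst₂ _≽⟨ p ⟩_ aj sj (at a≽s j))))
  where
  fill : ∀ {d} → nothing ≽⟨ p ⟩ just d → just c ≽⟨ p ⟩ just d
  fill spoilt = spoilt

module Endgame {N : ℕ} (t : GameType) (φ : Formula N) (mayPass : Player → Set)
               (p : Player) (Inv : Assignment N → Set)
               (inv-set : ∀ {a i} b → Inv a → lookup a i ≡ nothing → Inv (a [ i ]≔ just b))
               (inv-wins : ∀ {a} → Inv a → Complete a → WinsAt t φ a p) where

  -- By induction on the number k of unset variables: p sets some unset
  -- variable arbitrarily, every opponent move keeps the invariant, and an
  -- opponent's pass hands the turn back to p.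
  forces-from : ∀ k q a → unset-count a ≡ k → Inv a → Forces t φ mayPass p q a
  forces-from k q a count inv with unset-or-complete a
  ... | inj₂ complete = end complete (inv-wins inv complete)
  forces-from zero q a count inv | inj₁ (i , ai)
    with trans (sym count) (unset-count-set a i true ai)
  ... | ()
  forces-from (suc k) q a count inv | inj₁ (i , ai) = dispatch q
    where
    next : ∀ q′ {j} b → lookup a j ≡ nothing → Forces t φ mayPass p q′ (a [ j ]≔ just b)
    next q′ {j} b aj =
      forces-from k q′ _ (suc-injective (trans (sym (unset-count-set a j b aj)) count))
                  (inv-set b inv aj)

    p-moves : ∀ {q′} → q′ ≡ p → Forces t φ mayPass p q′ a
    p-moves q′≡p = move (unset⇒incomplete a i ai) q′≡p i ai true (next _ true ai)

    dispatch : ∀ q′ → Forces t φ mayPass p q′ a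
    dispatch q′ with q′ ≟ᴾ p
    ... | yes q′≡p = p-moves q′≡p
    ... | no  q′≢p = respond (unset⇒incomplete a i ai) q′≢p (λ j b aj → next _ b aj)
                             (λ _ → p-moves (other-of-≢ q′≢p))

  forces : ∀ q a → Inv a → Forces t φ mayPass p q a
  forces q a = forces-from (unset-count a) q a refl

simulate : ∀ {N} t (φ : Formula N) p {mayPass mayPass′ : Player → Set}
           {q} {a s : Assignment N} →
           Forces t φ mayPass p q s → Improves p a s → Forces t φ mayPass′ p q a
simulate t φ p {mayPass′ = mayPass′} {q} {a} (end complete wins) a≽s =
  Endgame.forces t φ mayPass′ p (λ a′ → Improves p a′ _)
    (λ c a′≽s a′j → improves-fill c a′≽s a′j (proj₂ (complete _)))
    (λ a′≽s _ → wins-mono t φ p a′≽s wins)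
    q a a≽s
simulate t φ p {a = a} (move _ q≡p i si b strategy) a≽s =
  move (unset⇒incomplete a i ai) q≡p i ai b (simulate t φ p strategy (improves-update i a≽s same))
  where
  ai : lookup a i ≡ nothing
  ai = unset-improvement i a≽s si
simulate t φ p {mayPass′ = mayPass′} {q} {a} {s} (respond incomplete q≢p replies _) a≽s
  with unset-or-complete s
... | inj₂ complete = contradiction complete incomplete
... | inj₁ (k , sk) = respond (unset⇒incomplete a k ak) q≢p answer (λ _ → phantom)
  where
  ak : lookup a k ≡ nothing
  ak = unset-improvement k a≽s sk

  a≽phantom : Improves p a (s [ k ]≔ just (disliked p))
  a≽phantom = improves-updateʳ k a≽s (subst (_≽⟨ p ⟩ _) (sym ak) spoilt)

  phantom : Forces t φ mayPass′ p (other q) a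
  phantom = simulate t φ p (replies k (disliked p) sk) a≽phantom

  -- A real move on a variable unset in s is copied into the simulation;
  -- a move on a variable already set in s is answered by the phantom move.
  answer : ∀ j c → lookup a j ≡ nothing → Forces t φ mayPass′ p (other q) (a [ j ]≔ just c)
  answer j c aj with lookup s j in sj
  ... | nothing = simulate t φ p (replies j c sj) (improves-update j a≽s same)
  ... | just d  = simulate t φ p (replies k (disliked p) sk)
                    (improves-fill c a≽phantom aj (proj₂ (set-stays-set s k (disliked p) sj)))

lemma2 : (t : GameType) (N : ℕ) (φ : Formula N) (p : Player) →
    HasWinningStrategy t φ NoPass p →
    HasWinningStrategy t φ (OpponentMayPass p) p
lemma2 t N φ p winning = simulate t φ p winning (improves λ i → same)
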